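{- Let $n>2$ be an odd integer. Then for every integer $a$, $a^{n-1} \not\equiv -1 \pmod n$. -}

module Defs where

module Submission where

-- Let n > 2 be odd, write n − 1 = 2^s·d with d odd, and suppose n ∣ a^(n−1) + 1.
-- Then n ∣ E + 1 for E = C^(2^s), C = a^d.  The heart of the argument is that
-- every prime p ∣ C^(2^s) + 1 is ≡ 1 (mod 2^(s+1)): if p − 1 = 2^t·d′ with d′ odd
-- and t ≤ s, Fermat's little theorem gives p ∣ (C^(p−1))^(2^(s−t)) − 1 = E^d′ − 1,
-- while p ∣ E + 1 ∣ E^d′ + 1, forcing p ∣ 2.  Multiplying over the prime
-- factorisation, n ≡ 1 (mod 2^(s+1)), contradicting the choice of s.

module BinomialCoefficients where
  open import Data.Nat
  open import Data.Nat.Properties using (*-comm; *-zeroʳ; *-identityʳ; +-identityʳ; <⇒≱)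
  open import Data.Nat.Combinatorics using (_C_; nC1≡n; nCk+nC[k+1]≡[n+1]C[k+1])
  open import Data.Nat.Divisibility using (_∣_; divides; ∣⇒≤)
  open import Data.Nat.Primality using (Prime; euclidsLemma)
  open import Data.Nat.Tactic.RingSolver using (solve-∀)
  open import Data.Sum using (inj₁; inj₂)
  open import Relation.Binary.PropositionalEquality
  open import Relation.Nullary using (contradiction)

  absorption : ∀ n k → suc k * (suc n C suc k) ≡ suc n * (n C k)
  absorption zero    zero    = refl
  absorption zero    (suc k) = *-zeroʳ (2 + k)
  absorption (suc n) zero    = trans (+-identityʳ _) (trans (nC1≡n (2 + n)) (sym (*-identityʳ _)))
  absorption (suc n) (suc k) = begin
    (2 + k) * (suc (suc n) C suc (suc k))
      ≡⟨ cong ((2 + k) *_) (sym (nCk+nC[k+1]≡[n+1]C[k+1] (suc n) (suc k))) ⟩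
    (2 + k) * (A + B)
      ≡⟨ regroup k A B ⟩
    (1 + k) * A + A + (2 + k) * B
      ≡⟨ cong₂ (λ u v → u + A + v) (absorption n k) (absorption n (suc k)) ⟩
    (1 + n) * (n C k) + A + (1 + n) * (n C suc k)
      ≡⟨ collect n (n C k) (n C suc k) A ⟩
    (1 + n) * (n C k + n C suc k) + A
      ≡⟨ cong (λ u → (1 + n) * u + A) (nCk+nC[k+1]≡[n+1]C[k+1] n k) ⟩
    (1 + n) * A + A
      ≡⟨ one-more-copy (1 + n) A ⟩
    (2 + n) * A ∎
    where
    open ≡-Reasoning
    A B : ℕ
    A = suc n C suc k
    B = suc n C suc (suc k)
    regroup : ∀ k a b → (2 + k) * (a + b) ≡ (1 + k) * a + a + (2 + k) * b
    regroup = solve-∀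
    collect : ∀ n a b c → (1 + n) * a + c + (1 + n) * b ≡ (1 + n) * (a + b) + c
    collect = solve-∀
    one-more-copy : ∀ m c → m * c + c ≡ suc m * c
    one-more-copy = solve-∀

  -- A prime p divides every binomial coefficient C(p,k) with 0 < k < p:
  -- by absorption p ∣ k·C(p,k), and p ∤ k since 0 < k < p.
  prime∣binomial : ∀ {p} k → Prime p → 0 < k → k < p → p ∣ p C k
  prime∣binomial {suc n} (suc k) pr _ (s≤s k<n)
    with euclidsLemma (suc k) (suc n C suc k) pr
           (divides (n C k) (trans (absorption n k) (*-comm (suc n) (n C k))))
  ... | inj₁ p∣k = contradiction (∣⇒≤ p∣k) (<⇒≱ (s≤s k<n))
  ... | inj₂ p∣C = p∣C

module FermatLittle where
  open import Data.Nat as ℕ using (ℕ; zero; suc; s≤s; z≤n)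
  open import Data.Nat.Primality using (Prime; euclidsLemma)
  open import Data.Nat.Combinatorics using (_C_; nCn≡1)
  import Data.Nat.Properties as ℕ
  open import Data.Integer hiding (suc)
  open import Data.Integer.Properties
    using (suc-*; *-identityˡ; *-identityʳ; ^-zeroˡ; abs-*; +-*-commutativeSemiring; +-*-semiring; +-0-monoid)
  open import Data.Integer.Divisibility.Signed
  open import Data.Integer.Tactic.RingSolver using (solve-∀)
  open import Data.Fin as Fin using (Fin; toℕ; fromℕ; inject₁)
  open import Data.Fin.Properties using (toℕ-fromℕ; toℕ-inject₁; toℕ<n)
  open import Data.Vec.Functional using (tail; init; last)
  open import Data.Sum using (_⊎_; inj₁; inj₂)
  open import Data.Nat.Divisibility using () renaming (_∣_ to _∣ℕ_)
  open import Relation.Binary.PropositionalEquality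
  open import Relation.Nullary using (¬_; contradiction)
  import Algebra.Properties.CommutativeSemiring.Binomial +-*-commutativeSemiring as Binomial
  open import Algebra.Properties.Semiring.Mult +-*-semiring using (_×_)
  import Algebra.Properties.Semiring.Exp +-*-semiring as Exp
  open import Algebra.Properties.Monoid.Sum +-0-monoid using (sum; sum-init-last)
  open BinomialCoefficients using (prime∣binomial)

  ×≡* : ∀ m x → m × x ≡ + m * x
  ×≡* zero    x = refl
  ×≡* (suc m) x = trans (cong (λ y → x + y) (×≡* m x)) (sym (suc-* (+ m) x))

  ^′≡^ : ∀ x n → x Exp.^ n ≡ x ^ n
  ^′≡^ x zero    = refl
  ^′≡^ x (suc n) = cong (x *_) (^′≡^ x n)

  ∣-sum : ∀ {d} n (f : Fin n → ℤ) → (∀ i → d ∣ f i) → d ∣ sum f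
  ∣-sum zero    f d∣f = divides 0ℤ refl
  ∣-sum (suc n) f d∣f = ∣m∣n⇒∣m+n (d∣f Fin.zero) (∣-sum n (tail f) (λ i → d∣f (Fin.suc i)))

  -- The "freshman's dream": (1 + x)^p ≡ 1 + x^p (mod p) for a prime p.
  -- Expanding (1 + x)^p binomially, the terms k = 0 and k = p are x^p and 1,
  -- and every other term has the factor C(p,k), which p divides.
  freshman : ∀ {p} → Prime p → ∀ x → + p ∣ (1ℤ + x) ^ p - (1ℤ + x ^ p)
  freshman {suc n} pr x = subst (+ suc n ∣_) (sym difference) (∣-sum n middle middle∣)
    where
    open ≡-Reasoning
    term : Fin (suc (suc n)) → ℤ
    term = Binomial.binomialTerm 1ℤ x (suc n)

    middle : Fin n → ℤ
    middle = init (tail term)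

    middle∣ : ∀ i → + suc n ∣ middle i
    middle∣ i = subst (+ suc n ∣_) (sym (×≡* (suc n C suc k) _))
      (∣m⇒∣m*n {m = + (suc n C suc k)} (Binomial.binomial 1ℤ x (suc n) (Fin.suc (inject₁ i)))
        (∣ᵤ⇒∣ (prime∣binomial (suc k) pr (s≤s z≤n) (s≤s k<n))))
      where
      k : ℕ
      k = toℕ (inject₁ i)
      k<n : k ℕ.< n
      k<n = subst (ℕ._< n) (sym (toℕ-inject₁ i)) (toℕ<n i)

    first : term Fin.zero ≡ x ^ suc n
    first = begin
      1 × (1ℤ * x Exp.^ suc n) ≡⟨ ×≡* 1 _ ⟩
      1ℤ * (1ℤ * x Exp.^ suc n) ≡⟨ cong (λ y → 1ℤ * (1ℤ * y)) (^′≡^ x (suc n)) ⟩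
      1ℤ * (1ℤ * x ^ suc n)     ≡⟨ trans (*-identityˡ _) (*-identityˡ _) ⟩
      x ^ suc n                 ∎

    final : last term ≡ 1ℤ
    final = begin
      (suc n C suc m) × (1ℤ Exp.^ suc m * x Exp.^ (n ℕ.∸ m))
        ≡⟨ cong (λ k → (suc n C suc k) × (1ℤ Exp.^ suc k * x Exp.^ (n ℕ.∸ k))) (toℕ-fromℕ n) ⟩
      (suc n C suc n) × (1ℤ Exp.^ suc n * x Exp.^ (n ℕ.∸ n))
        ≡⟨ cong₂ (λ c e → c × (1ℤ Exp.^ suc n * x Exp.^ e)) (nCn≡1 (suc n)) (ℕ.n∸n≡0 n) ⟩
      1 × (1ℤ Exp.^ suc n * 1ℤ)
        ≡⟨ trans (×≡* 1 _) (*-identityˡ _) ⟩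
      1ℤ Exp.^ suc n * 1ℤ
        ≡⟨ trans (*-identityʳ _) (trans (^′≡^ 1ℤ (suc n)) (^-zeroˡ (suc n))) ⟩
      1ℤ ∎
      where
      m : ℕ
      m = toℕ (fromℕ n)

    expansion : (1ℤ + x) ^ suc n ≡ x ^ suc n + (sum middle + 1ℤ)
    expansion = begin
      (1ℤ + x) ^ suc n                        ≡⟨ sym (^′≡^ (1ℤ + x) (suc n)) ⟩
      (1ℤ + x) Exp.^ suc n                    ≡⟨ Binomial.theorem (suc n) 1ℤ x ⟩
      term Fin.zero + sum (tail term)         ≡⟨ cong₂ _+_ first (sum-init-last (tail term)) ⟩
      x ^ suc n + (sum middle + last term)    ≡⟨ cong (λ y → x ^ suc n + (sum middle + y)) final ⟩
      x ^ suc n + (sum middle + 1ℤ)           ∎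

    difference : (1ℤ + x) ^ suc n - (1ℤ + x ^ suc n) ≡ sum middle
    difference = trans (cong (_- (1ℤ + x ^ suc n)) expansion) (cancel (x ^ suc n) (sum middle))
      where
      cancel : ∀ y m → y + (m + 1ℤ) - (1ℤ + y) ≡ m
      cancel = solve-∀

  -- (1 + x)^p − (1 + x) splits as [(1 + x)^p − (1 + x^p)] + [x^p − x]; the first
  -- summand is a multiple of p, so p divides x^p − x iff it divides (1 + x)^p − (1 + x).
  split-step : ∀ a b x → a - (1ℤ + x) ≡ (a - (1ℤ + b)) + (b - x)
  split-step = solve-∀

  fermat-step : ∀ {p} → Prime p → ∀ x → + p ∣ x ^ p - x → + p ∣ (1ℤ + x) ^ p - (1ℤ + x)
  fermat-step {p} pr x p∣ = subst (+ p ∣_) (sym (split-step ((1ℤ + x) ^ p) (x ^ p) x))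
    (∣m∣n⇒∣m+n (freshman pr x) p∣)

  fermat-step⁻¹ : ∀ {p} → Prime p → ∀ x → + p ∣ (1ℤ + x) ^ p - (1ℤ + x) → + p ∣ x ^ p - x
  fermat-step⁻¹ {p} pr x p∣ =
    ∣m+n∣m⇒∣n (subst (+ p ∣_) (split-step ((1ℤ + x) ^ p) (x ^ p) x) p∣) (freshman pr x)

  fermat-ℕ : ∀ {p} → Prime p → ∀ m → + p ∣ (+ m) ^ p - + m
  fermat-ℕ {suc n} pr zero    = divides 0ℤ refl
  fermat-ℕ         pr (suc m) = fermat-step pr (+ m) (fermat-ℕ pr m)

  fermat : ∀ {p} → Prime p → ∀ x → + p ∣ x ^ p - x
  fermat pr (+ m)             = fermat-ℕ pr m
  fermat pr -[1+ zero ]       = fermat-step⁻¹ pr -1ℤ (fermat-ℕ pr 0)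
  fermat pr -[1+ suc m ]      = fermat-step⁻¹ pr -[1+ suc m ] (fermat pr -[1+ m ])

  prime∣*⇒∣ : ∀ {p} → Prime p → ∀ x y → + p ∣ x * y → (+ p ∣ x) ⊎ (+ p ∣ y)
  prime∣*⇒∣ pr x y p∣xy with euclidsLemma ∣ x ∣ ∣ y ∣ pr (subst (_ ∣ℕ_) (abs-* x y) (∣⇒∣ᵤ p∣xy))
  ... | inj₁ p∣x = inj₁ (∣ᵤ⇒∣ p∣x)
  ... | inj₂ p∣y = inj₂ (∣ᵤ⇒∣ p∣y)

  -- Fermat's little theorem for units: if p ∤ x then p ∣ x^(p−1) − 1,
  -- since x^p − x = x · (x^(p−1) − 1).
  fermat-unit : ∀ {p} → Prime p → ∀ x → ¬ (+ p ∣ x) → + p ∣ x ^ (p ℕ.∸ 1) - 1ℤ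
  fermat-unit {suc n} pr x p∤x
    with prime∣*⇒∣ pr x (x ^ n - 1ℤ) (subst (+ suc n ∣_) (factor x (x ^ n)) (fermat pr x))
    where
    factor : ∀ x y → x * y - x ≡ x * (y - 1ℤ)
    factor = solve-∀
  ... | inj₁ p∣x = contradiction p∣x p∤x
  ... | inj₂ p∣y = p∣y

module GeometricDivisibility where
  open import Data.Nat as ℕ using (ℕ; zero; suc)
  import Data.Nat.Properties as ℕ
  open import Data.Integer hiding (suc)
  open import Data.Integer.Properties using (*-identityʳ)
  open import Data.Integer.Divisibility.Signed
  open import Data.Integer.Tactic.RingSolver using (solve-∀)
  open import Relation.Binary.PropositionalEquality

  -- y − 1 divides y^k − 1, since y^(k+1) − 1 = y·(y^k − 1) + (y − 1).
  y-1∣y^k-1 : ∀ k y → y - 1ℤ ∣ y ^ k - 1ℤ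
  y-1∣y^k-1 zero    y = divides 0ℤ refl
  y-1∣y^k-1 (suc k) y = subst (y - 1ℤ ∣_) (unfold y (y ^ k))
    (∣m∣n⇒∣m+n (∣n⇒∣m*n y (y-1∣y^k-1 k y)) ∣-refl)
    where
    unfold : ∀ y z → y * (z - 1ℤ) + (y - 1ℤ) ≡ y * z - 1ℤ
    unfold = solve-∀

  -- For odd exponents, y + 1 divides y^(2j+1) + 1, since
  -- y^(2j+3) + 1 = y²·(y^(2j+1) + 1) − (y + 1)(y − 1).
  y+1∣y^odd+1 : ∀ j y → y + 1ℤ ∣ y ^ suc (2 ℕ.* j) + 1ℤ
  y+1∣y^odd+1 zero    y = subst (y + 1ℤ ∣_) (cong (_+ 1ℤ) (sym (*-identityʳ y))) ∣-refl
  y+1∣y^odd+1 (suc j) y = subst (y + 1ℤ ∣_) unfold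
    (∣m∣n⇒∣m-n (∣n⇒∣m*n (y * y) (y+1∣y^odd+1 j y)) (∣m⇒∣m*n (y - 1ℤ) ∣-refl))
    where
    open ≡-Reasoning
    expand : ∀ y z → y * y * (y * z + 1ℤ) - (y + 1ℤ) * (y - 1ℤ) ≡ y * (y * (y * z)) + 1ℤ
    expand = solve-∀
    unfold : y * y * (y ^ suc (2 ℕ.* j) + 1ℤ) - (y + 1ℤ) * (y - 1ℤ) ≡ y ^ suc (2 ℕ.* suc j) + 1ℤ
    unfold = begin
      y * y * (y ^ suc (2 ℕ.* j) + 1ℤ) - (y + 1ℤ) * (y - 1ℤ) ≡⟨ expand y (y ^ (2 ℕ.* j)) ⟩
      y ^ (3 ℕ.+ 2 ℕ.* j) + 1ℤ                                ≡⟨ cong (λ e → y ^ suc e + 1ℤ) (sym (ℕ.*-suc 2 j)) ⟩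
      y ^ suc (2 ℕ.* suc j) + 1ℤ                              ∎

module CongruentToOne where
  open import Data.Nat
  open import Data.Nat.Divisibility using (_∣_; _∣0; ∣m∣n⇒∣m+n; ∣m⇒∣m*n)
  open import Data.Nat.Primality using (Prime)
  open import Data.Nat.Primality.Factorisation using (factorise; PrimeFactorisation)
  open import Data.Nat.ListAction using (product)
  open import Data.Nat.ListAction.Properties using (∈⇒∣product)
  open import Data.List using ([]; _∷_)
  open import Data.List.Membership.Propositional using (_∈_)
  open import Data.List.Relation.Unary.All as All using (All; []; _∷_)
  open import Relation.Binary.PropositionalEquality

  -- n ≡ 1 (mod g), phrased without subtraction: n is one more than a multiple of g.
  infix 4 _≡1[mod_]
  data _≡1[mod_] : ℕ → ℕ → Set where
    one-more : ∀ {g m} → g ∣ m → suc m ≡1[mod g ]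

  -- Closure under multiplication: (m + 1)(k + 1) = (k + m(k + 1)) + 1.
  ≡1-* : ∀ {g a b} → a ≡1[mod g ] → b ≡1[mod g ] → a * b ≡1[mod g ]
  ≡1-* (one-more g∣m) (one-more g∣k) = one-more (∣m∣n⇒∣m+n g∣k (∣m⇒∣m*n _ g∣m))

  ≡1-product : ∀ {g} ns → All (λ n → n ≡1[mod g ]) ns → product ns ≡1[mod g ]
  ≡1-product {g} []       []         = one-more (g ∣0)
  ≡1-product     (n ∷ ns) (n≡1 ∷ ns≡1) = ≡1-* n≡1 (≡1-product ns ns≡1)

  prime-divisors-≡1 : ∀ {g} n → .{{NonZero n}} →
    (∀ {p} → Prime p → p ∣ n → p ≡1[mod g ]) → n ≡1[mod g ]
  prime-divisors-≡1 n prime-divisor-≡1 =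
    subst (λ m → m ≡1[mod _ ]) (sym isFactorisation) (≡1-product factors (All.tabulate factor-≡1))
    where
    open PrimeFactorisation (factorise n)
    factor-≡1 : ∀ {p} → p ∈ factors → p ≡1[mod _ ]
    factor-≡1 p∈ = prime-divisor-≡1 (All.lookup factorsPrime p∈)
      (subst (_ ∣_) (sym isFactorisation) (∈⇒∣product p∈))

module TwoAdicDecomposition where
  open import Data.Nat
  open import Data.Nat.Properties using (*-suc; *-assoc; *-comm; +-identityʳ; m<m+n; m^n≢0; even≢odd)
  open import Data.Nat.Divisibility using (_∣_; divides; *-cancelˡ-∣)
  open CongruentToOne using (_≡1[mod_]; one-more)
  open import Relation.Nullary using (¬_; contradiction)
  open import Data.Nat.Induction using (<-rec)
  open import Data.Product using (∃; ∃₂; _,_)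
  open import Data.Sum using (_⊎_; inj₁; inj₂)
  open import Relation.Binary.PropositionalEquality

  even-or-odd : ∀ m → (∃ λ k → m ≡ 2 * k) ⊎ (∃ λ k → m ≡ suc (2 * k))
  even-or-odd zero    = inj₁ (0 , refl)
  even-or-odd (suc m) with even-or-odd m
  ... | inj₁ (k , m≡2k)   = inj₂ (k , cong suc m≡2k)
  ... | inj₂ (k , m≡2k+1) = inj₁ (suc k , trans (cong suc m≡2k+1) (sym (*-suc 2 k)))

  TwoAdic : ℕ → Set
  TwoAdic m = ∃₂ λ t u → m ≡ 2 ^ t * suc (2 * u)

  two-adic : ∀ m → .{{NonZero m}} → TwoAdic m
  two-adic = <-rec (λ m → .{{NonZero m}} → TwoAdic m) step
    where
    step : ∀ m → (∀ {k} → k < m → .{{NonZero k}} → TwoAdic k) → .{{NonZero m}} → TwoAdic m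
    step m smaller with even-or-odd m
    ... | inj₂ (u , m≡2u+1) = 0 , u , trans m≡2u+1 (sym (+-identityʳ _))
    ... | inj₁ (zero , m≡0) = contradiction m≡0 (≢-nonZero⁻¹ m)
    ... | inj₁ (suc k , m≡2k) with smaller {suc k} (subst (suc k <_) (sym m≡2k) (m<m+n (suc k) z<s))
    ...   | t , u , k≡ = suc t , u , trans m≡2k (trans (cong (2 *_) k≡) (sym (*-assoc 2 (2 ^ t) _)))

  2∤odd : ∀ u → ¬ (2 ∣ suc (2 * u))
  2∤odd u (divides q odd≡q*2) = even≢odd q u (sym (trans odd≡q*2 (*-comm q 2)))

  -- If m = 2^s·d with d odd, then m + 1 is not ≡ 1 (mod 2^(s+1)):
  -- 2^(s+1) ∣ 2^s·d would give 2 ∣ d.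
  exact-valuation : ∀ {m} s u → m ≡ 2 ^ s * suc (2 * u) → ¬ (suc m ≡1[mod 2 ^ suc s ])
  exact-valuation s u m≡ (one-more 2^[s+1]∣m) =
    2∤odd u (*-cancelˡ-∣ (2 ^ s) {{m^n≢0 2 s}} (subst₂ _∣_ (*-comm 2 (2 ^ s)) m≡ 2^[s+1]∣m))

module PrimeDivisorsOfPowerPlusOne where
  open import Data.Nat as ℕ using (ℕ; suc; _≤_; s≤s; _≤?_; NonZero)
  import Data.Nat.Properties as ℕ
  open import Data.Nat.Divisibility as ℕ∣ using () renaming (_∣_ to _∣ℕ_)
  open import Data.Nat.Primality using (Prime; ¬prime[0]; ¬prime[1])
  open import Data.Nat.Tactic.RingSolver as ℕ-Solver using ()
  open import Data.Integer using (ℤ; +_; _+_; _-_; _^_; 1ℤ)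
  open import Data.Integer.Properties using (^-*-assoc)
  open import Data.Integer.Divisibility.Signed
  open import Data.Integer.Tactic.RingSolver using (solve-∀)
  open import Data.Product using (_,_)
  open import Relation.Binary.PropositionalEquality
  open import Relation.Nullary using (¬_; yes; no; contradiction)
  open FermatLittle using (fermat-unit)
  open GeometricDivisibility using (y-1∣y^k-1; y+1∣y^odd+1)
  open TwoAdicDecomposition using (two-adic)
  open CongruentToOne using (_≡1[mod_]; one-more)

  odd-prime∤2 : ∀ {p} → Prime p → ¬ (2 ∣ℕ p) → ¬ (p ∣ℕ 2)
  odd-prime∤2 {0}                 pr odd p∣2 = ¬prime[0] pr
  odd-prime∤2 {1}                 pr odd p∣2 = ¬prime[1] pr
  odd-prime∤2 {2}                 pr odd p∣2 = odd ℕ∣.∣-refl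
  odd-prime∤2 {suc (suc (suc _))} pr odd p∣2 with ℕ∣.∣⇒≤ p∣2
  ... | s≤s (s≤s ())

  ∣⇒∣^ : ∀ {d y} k → .{{NonZero k}} → d ∣ y → d ∣ y ^ k
  ∣⇒∣^ (suc k) d∣y = ∣m⇒∣m*n _ d∣y

  -- A prime dividing y^(2^s) + 1 does not divide y: otherwise it would divide 1.
  prime∤base : ∀ {p} s y → Prime p → + p ∣ y ^ (2 ℕ.^ s) + 1ℤ → ¬ (+ p ∣ y)
  prime∤base {p} s y pr p∣E+1 p∣y = ¬prime[1] (subst Prime (ℕ∣.∣1⇒≡1 (∣⇒∣ᵤ p∣1)) pr)
    where
    p∣E : + p ∣ y ^ (2 ℕ.^ s)
    p∣E = ∣⇒∣^ (2 ℕ.^ s) {{ℕ.m^n≢0 2 s}} p∣y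
    p∣1 : + p ∣ 1ℤ
    p∣1 = subst (+ p ∣_) (cancel (y ^ (2 ℕ.^ s))) (∣m∣n⇒∣m-n p∣E+1 p∣E)
      where
      cancel : ∀ e → e + 1ℤ - e ≡ 1ℤ
      cancel = solve-∀

  ∣-both⇒∣2 : ∀ {d} z → d ∣ z + 1ℤ → d ∣ z - 1ℤ → d ∣ + 2
  ∣-both⇒∣2 z d∣z+1 d∣z-1 = subst (_ ∣_) (difference z) (∣m∣n⇒∣m-n d∣z+1 d∣z-1)
    where
    difference : ∀ z → z + 1ℤ - (z - 1ℤ) ≡ + 2
    difference = solve-∀

  ^-mono-∣ : ∀ x {a b} → a ≤ b → x ℕ.^ a ∣ℕ x ℕ.^ b
  ^-mono-∣ x {a} {b} a≤b = subst (x ℕ.^ a ∣ℕ_) split (ℕ∣.m∣m*n (x ℕ.^ (b ℕ.∸ a)))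
    where
    split : x ℕ.^ a ℕ.* x ℕ.^ (b ℕ.∸ a) ≡ x ℕ.^ b
    split = trans (sym (ℕ.^-distribˡ-+-* x a (b ℕ.∸ a))) (cong (x ℕ.^_) (ℕ.m+[n∸m]≡n a≤b))

  rescale : ∀ {m} s t d → t ≤ s → m ≡ 2 ℕ.^ t ℕ.* d → m ℕ.* 2 ℕ.^ (s ℕ.∸ t) ≡ 2 ℕ.^ s ℕ.* d
  rescale {m} s t d t≤s m≡ = begin
    m ℕ.* 2 ℕ.^ (s ℕ.∸ t)                    ≡⟨ cong (ℕ._* 2 ℕ.^ (s ℕ.∸ t)) m≡ ⟩
    2 ℕ.^ t ℕ.* d ℕ.* 2 ℕ.^ (s ℕ.∸ t)        ≡⟨ swap (2 ℕ.^ t) d (2 ℕ.^ (s ℕ.∸ t)) ⟩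
    2 ℕ.^ t ℕ.* 2 ℕ.^ (s ℕ.∸ t) ℕ.* d        ≡⟨ cong (ℕ._* d) (sym (ℕ.^-distribˡ-+-* 2 t (s ℕ.∸ t))) ⟩
    2 ℕ.^ (t ℕ.+ (s ℕ.∸ t)) ℕ.* d            ≡⟨ cong (λ e → 2 ℕ.^ e ℕ.* d) (ℕ.m+[n∸m]≡n t≤s) ⟩
    2 ℕ.^ s ℕ.* d                            ∎
    where
    open ≡-Reasoning
    swap : ∀ a b c → a ℕ.* b ℕ.* c ≡ a ℕ.* c ℕ.* b
    swap = ℕ-Solver.solve-∀

  -- If p − 1 = 2^t·d with d odd and t ≤ s, a prime p dividing E + 1, where
  -- E = y^(2^s), must divide 2: by Fermat p ∣ y^(p−1) − 1, and raising y^(p−1)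
  -- to the power 2^(s−t) gives E^d, so p ∣ E^d − 1; while E + 1 ∣ E^d + 1.
  low-valuation⇒∣2 : ∀ {m} s t u y → Prime (suc m) → m ≡ 2 ℕ.^ t ℕ.* suc (2 ℕ.* u) → t ≤ s →
    + suc m ∣ y ^ (2 ℕ.^ s) + 1ℤ → + suc m ∣ + 2
  low-valuation⇒∣2 {m} s t u y pr m≡ t≤s p∣E+1 = ∣-both⇒∣2 (E ^ d) p∣E^d+1 p∣E^d-1
    where
    E : ℤ
    E = y ^ (2 ℕ.^ s)
    d : ℕ
    d = suc (2 ℕ.* u)

    p∣y^m-1 : + suc m ∣ y ^ m - 1ℤ
    p∣y^m-1 = fermat-unit pr y (prime∤base s y pr p∣E+1)

    same-power : (y ^ m) ^ (2 ℕ.^ (s ℕ.∸ t)) ≡ E ^ d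
    same-power = begin
      (y ^ m) ^ (2 ℕ.^ (s ℕ.∸ t))    ≡⟨ ^-*-assoc y m (2 ℕ.^ (s ℕ.∸ t)) ⟩
      y ^ (m ℕ.* 2 ℕ.^ (s ℕ.∸ t))    ≡⟨ cong (y ^_) (rescale s t d t≤s m≡) ⟩
      y ^ (2 ℕ.^ s ℕ.* d)            ≡⟨ sym (^-*-assoc y (2 ℕ.^ s) d) ⟩
      E ^ d                          ∎
      where open ≡-Reasoning

    p∣E^d-1 : + suc m ∣ E ^ d - 1ℤ
    p∣E^d-1 = subst (λ z → + suc m ∣ z - 1ℤ) same-power
      (∣-trans p∣y^m-1 (y-1∣y^k-1 (2 ℕ.^ (s ℕ.∸ t)) (y ^ m)))

    p∣E^d+1 : + suc m ∣ E ^ d + 1ℤ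
    p∣E^d+1 = ∣-trans p∣E+1 (y+1∣y^odd+1 u E)

  -- Every odd prime divisor p of y^(2^s) + 1 satisfies p ≡ 1 (mod 2^(s+1)):
  -- writing p − 1 = 2^t·d with d odd, the case t ≤ s is excluded above, so
  -- t ≥ s + 1 and 2^(s+1) ∣ 2^t ∣ p − 1.
  prime-divisor-≡1 : ∀ {p} s y → Prime p → ¬ (2 ∣ℕ p) → + p ∣ y ^ (2 ℕ.^ s) + 1ℤ →
    p ≡1[mod 2 ℕ.^ suc s ]
  prime-divisor-≡1 {0}             s y pr = contradiction pr ¬prime[0]
  prime-divisor-≡1 {1}             s y pr = contradiction pr ¬prime[1]
  prime-divisor-≡1 {suc m@(suc _)} s y pr odd p∣E+1 with two-adic m
  ... | t , u , m≡ with t ≤? s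
  ... | yes t≤s = contradiction (∣⇒∣ᵤ (low-valuation⇒∣2 s t u y pr m≡ t≤s p∣E+1)) (odd-prime∤2 pr odd)
  ... | no  t≰s = one-more (subst (2 ℕ.^ suc s ∣ℕ_) (sym m≡)
                    (ℕ∣.∣-trans (^-mono-∣ 2 (ℕ.≰⇒> t≰s)) (ℕ∣.m∣m*n _)))

open import Defs
open import Data.Nat using (ℕ; _<_; _∸_)
open import Data.Nat.Divisibility using () renaming (_∣_ to _∣ℕ_)
open import Data.Integer using (ℤ; +_; -_; _-_; _^_; -1ℤ)
open import Data.Integer.Divisibility using (_∣_)
open import Relation.Nullary using (¬_)

open import Data.Nat using (suc; s≤s)
import Data.Nat as ℕ
open import Data.Nat.Properties using (*-comm)
import Data.Nat.Divisibility as ℕ∣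
open import Data.Integer using (_+_; 1ℤ)
open import Data.Integer.Properties using (^-*-assoc)
import Data.Integer.Divisibility.Signed as Signed
open import Data.Product using (_,_)
open import Relation.Binary.PropositionalEquality using (_≡_; trans; sym; cong; subst)
open import Data.Nat.Primality using (Prime)
open CongruentToOne using (_≡1[mod_]; prime-divisors-≡1)
open TwoAdicDecomposition using (two-adic; exact-valuation)
open PrimeDivisorsOfPowerPlusOne using (prime-divisor-≡1)

-- Write n − 1 = 2^s·d with d odd. If n ∣ a^(n−1) + 1 = (a^d)^(2^s) + 1, every
-- prime divisor of the odd number n is ≡ 1 (mod 2^(s+1)), hence so is n;
-- this contradicts the exact power 2^s dividing n − 1.
lemma2p1 : (n : ℕ) → 2 < n → ¬ (2 ∣ℕ n) →
    (a : ℤ) → ¬ ((+ n) ∣ ((a ^ (n ∸ 1)) - -1ℤ))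
lemma2p1 (suc m) (s≤s (s≤s (s≤s _))) n-odd a n∣a^m+1 with two-adic m
... | s , u , m≡ = exact-valuation s u m≡ (prime-divisors-≡1 (suc m) prime-divisor-of-n-≡1)
  where
  d : ℕ
  d = suc (2 ℕ.* u)

  a^m≡ : a ^ m ≡ (a ^ d) ^ (2 ℕ.^ s)
  a^m≡ = trans (cong (a ^_) (trans m≡ (*-comm (2 ℕ.^ s) d))) (sym (^-*-assoc a d (2 ℕ.^ s)))

  n∣ : + suc m Signed.∣ (a ^ d) ^ (2 ℕ.^ s) + 1ℤ
  n∣ = subst (λ z → + suc m Signed.∣ z + 1ℤ) a^m≡ (Signed.∣ᵤ⇒∣ n∣a^m+1)

  prime-divisor-of-n-≡1 : ∀ {p} → Prime p → p ∣ℕ suc m → p ≡1[mod 2 ℕ.^ suc s ]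
  prime-divisor-of-n-≡1 pr p∣n = prime-divisor-≡1 s (a ^ d) pr
    (λ 2∣p → n-odd (ℕ∣.∣-trans 2∣p p∣n)) (Signed.∣-trans (Signed.∣ᵤ⇒∣ p∣n) n∣)
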